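{- Let $a,b,c,d$ be integers with $a>0$, $c>0$, $b>1$, $d>1$ and $\gcd(a,c)=\gcd(b,d)=1$. Let $f_a,f_c$ be positive integers with $f_a\mid a$, $f_c\mid c$ and $a(b-1)+f_a=c(d-1)+f_c=:N$. Let $r_1<\dots<r_{a(b-1)}$ be the residues in $\{1,\dots,ab-1\}$ not divisible by $b$ and $s_1<\dots<s_{c(d-1)}$ the residues in $\{1,\dots,cd-1\}$ not divisible by $d$. Consider the list of $N$ residue classes (modulus, residue) $$(f_ab,0),(f_ab,b),\dots,(f_ab,(f_a-1)b),(ab,r_1),\dots,(ab,r_{a(b-1)})$$ and the list of $N$ residue classes $$(f_cd,0),(f_cd,d),\dots,(f_cd,(f_c-1)d),(cd,s_1),\dots,(cd,s_{c(d-1)}),$$ and write the $k$-th entry of the first list as $(M_k,t_k)$ and of the second as $(M'_k,t'_k)$. Define $f:\mathbb{N}_0\to\mathbb{N}_0$ by $f(M_kn+t_k)=M'_kn+t'_k$ for all $n\in\mathbb{N}_0$ and $k=1,\dots,N$. Then $f$ is well defined and is a permutation (bijection) of $\mathbb{N}_0$.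
   Context: $\mathbb{N}_0=\{0,1,2,\dots\}$. -}

module Defs where

open import Data.Nat using (ℕ; suc; _+_; _*_; _∸_)
open import Data.Nat.Divisibility using (_∣?_)
open import Data.List using (List; map; filter; upTo; _++_)
open import Data.Product using (_×_; _,_)
open import Relation.Nullary.Decidable using (¬?)

residues : ℕ → ℕ → List ℕ
residues a b = filter (λ r → ¬? (b ∣? r)) (map suc (upTo (a * b ∸ 1)))

classes : ℕ → ℕ → ℕ → List (ℕ × ℕ)
classes a b fa =
  map (λ i → (fa * b , i * b)) (upTo fa) ++ map (λ r → (a * b , r)) (residues a b)

-- The first list is an exact covering system of ℕ: the classes (fa·b, i·b), i < fa, partition the
-- multiples of b (write x = q·b and divide q by fa), and the classes (a·b, r) with b ∤ r partition the
-- non-multiples (divide x by a·b). Exactly a − 1 of the numbers 1, …, a·b − 1 are multiples of b, so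
-- the list has a(b − 1) + fa = N classes; likewise for the second list. For any two exact coverings
-- with equally many classes, sending the n-th element of the k-th class of one to the n-th element of
-- the k-th class of the other is a bijection of ℕ, its inverse being the same map in the other direction.
module Submission where

open import Defs
open import Data.Nat using (ℕ; zero; suc; _+_; _*_; _∸_; _>_; _<_; _≤_; z<s; s≤s; _%_; _/_; NonZero; >-nonZero)
open import Data.Nat.Properties
open import Data.Nat.Divisibility using (_∣_; _∣?_; divides; ∣m+n∣m⇒∣n; ∣m∣n⇒∣m+n; n∣m*n; n∣m*n*o; ∣⇒≤; ∣n∣m%n⇒∣m)
open import Data.Nat.DivMod using (m≡m%n+[m/n]*n; m%n<n; [m+kn]%n≡m%n; m<n⇒m%n≡m)
open import Data.Nat.GCD using (gcd)
open import Data.Nat.Tactic.RingSolver using (solve-∀)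
open import Data.List using (List; _∷_; [_]; zip; length; map; filter; upTo; _++_)
open import Data.List.Properties using (upTo-∷ʳ; map-++; filter-++; filter-accept; filter-reject; length-++; length-map; length-upTo)
open import Data.List.Membership.Propositional using (_∈_)
open import Data.List.Membership.Propositional.Properties using (∈-map⁺; ∈-map⁻; ∈-++⁺ˡ; ∈-++⁺ʳ; ∈-++⁻; ∈-filter⁺; ∈-filter⁻; ∈-upTo⁺; ∈-upTo⁻)
open import Data.List.Relation.Unary.Any using (here; there)
open import Data.List.Relation.Unary.AllPairs using (_∷_)
open import Data.List.Relation.Unary.Unique.Propositional using (Unique)
import Data.List.Relation.Unary.Unique.Propositional.Properties as Unique
open import Data.List.Relation.Unary.Unique.Propositional.Properties using (Unique[x∷xs]⇒x∉xs)
open import Data.Product using (Σ; ∃; ∃₂; _×_; _,_; proj₁; proj₂; uncurry)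
open import Data.Sum using (inj₁; inj₂)
open import Relation.Nullary using (¬_; Dec; yes; no; contradiction)
open import Relation.Nullary.Decidable using (¬?)
open import Relation.Binary.PropositionalEquality using (_≡_; refl; sym; trans; cong; cong₂; subst; module ≡-Reasoning)
open import Function using (_∘_)
open import Function.Definitions using (Bijective; Injective; Surjective)

Class : Set
Class = ℕ × ℕ

_at_ : Class → ℕ → ℕ
(M , t) at n = M * n + t

Representation : List Class → ℕ → Set
Representation L x = ∃ λ M → ∃ λ t → ∃ λ n → (M , t) ∈ L × x ≡ M * n + t

Covers : List Class → Set
Covers L = ∀ x → Representation L x

Disjoint : List Class → Set
Disjoint L = ∀ {e e′} n n′ → e ∈ L → e′ ∈ L → e at n ≡ e′ at n′ → e ≡ e′ × n ≡ n′

record ExactCovering (L : List Class) : Set where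
  field
    distinct : Unique L
    covers   : Covers L
    disjoint : Disjoint L

module _ {A B : Set} where

  ∈-zip⁻ˡ : ∀ {xs : List A} {ys : List B} {x y} → (x , y) ∈ zip xs ys → x ∈ xs
  ∈-zip⁻ˡ {_ ∷ _} {_ ∷ _} (here refl) = here refl
  ∈-zip⁻ˡ {_ ∷ _} {_ ∷ _} (there p)   = there (∈-zip⁻ˡ p)

  ∈-zip⁺ˡ : ∀ {xs : List A} {ys : List B} {x} → length xs ≡ length ys → x ∈ xs →
            ∃ λ y → (x , y) ∈ zip xs ys
  ∈-zip⁺ˡ {_ ∷ _} {y ∷ _} _  (here refl) = y , here refl
  ∈-zip⁺ˡ {_ ∷ _} {_ ∷ _} eq (there p)   with y , q ← ∈-zip⁺ˡ (suc-injective eq) p = y , there q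

  zip-functional : ∀ {xs : List A} {ys : List B} {x y y′} → Unique xs →
                   (x , y) ∈ zip xs ys → (x , y′) ∈ zip xs ys → y ≡ y′
  zip-functional {_ ∷ _} {_ ∷ _} _       (here refl) (here refl) = refl
  zip-functional {_ ∷ _} {_ ∷ _} u       (here refl) (there q)   = contradiction (∈-zip⁻ˡ q) (Unique[x∷xs]⇒x∉xs u)
  zip-functional {_ ∷ _} {_ ∷ _} u       (there p)   (here refl) = contradiction (∈-zip⁻ˡ p) (Unique[x∷xs]⇒x∉xs u)
  zip-functional {_ ∷ _} {_ ∷ _} (_ ∷ u) (there p)   (there q)   = zip-functional u p q

∈-zip-swap : ∀ {A B : Set} {xs : List A} {ys : List B} {x y} → (x , y) ∈ zip xs ys → (y , x) ∈ zip ys xs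
∈-zip-swap {xs = _ ∷ _} {_ ∷ _} (here refl) = here refl
∈-zip-swap {xs = _ ∷ _} {_ ∷ _} (there p)   = there (∈-zip-swap p)

module Matching {L L′ : List Class} (C : ExactCovering L) (C′ : ExactCovering L′)
                (|L|≡|L′| : length L ≡ length L′) where
  open ExactCovering

  partner : ∀ {e} → e ∈ L → Class
  partner p = proj₁ (∈-zip⁺ˡ {ys = L′} |L|≡|L′| p)

  partner-paired : ∀ {e} (p : e ∈ L) → (e , partner p) ∈ zip L L′
  partner-paired p = proj₂ (∈-zip⁺ˡ {ys = L′} |L|≡|L′| p)

  transfer : ∀ {x} → Representation L x → ℕ
  transfer (_ , _ , n , p , _) = partner p at n

  f : ℕ → ℕ
  f x = transfer (covers C x)

  transfer-unique : ∀ {x e e′ n} (ρ : Representation L x) → (e , e′) ∈ zip L L′ → x ≡ e at n →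
                    transfer ρ ≡ e′ at n
  transfer-unique (_ , _ , n₀ , p , x≡) z x≡′
    with refl , refl ← disjoint C n₀ _ p (∈-zip⁻ˡ z) (trans (sym x≡) x≡′)
    = cong (_at n₀) (zip-functional (distinct C) (partner-paired p) z)

  f-at : ∀ {e e′} n → (e , e′) ∈ zip L L′ → f (e at n) ≡ e′ at n
  f-at n z = transfer-unique (covers C _) z refl

  f-paired : ∀ x → ∃₂ λ e e′ → ∃ λ n → (e , e′) ∈ zip L L′ × x ≡ e at n × f x ≡ e′ at n
  f-paired x with M , t , n , p , x≡ ← covers C x =
    (M , t) , partner p , n , partner-paired p , x≡ , refl

  f-injective : Injective _≡_ _≡_ f
  f-injective {x} {y} fx≡fy
    with e₁ , e₁′ , n₁ , z₁ , x≡ , fx≡ ← f-paired x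
       | e₂ , e₂′ , n₂ , z₂ , y≡ , fy≡ ← f-paired y
    with refl , refl ← disjoint C′ n₁ n₂ (∈-zip⁻ˡ (∈-zip-swap z₁)) (∈-zip⁻ˡ (∈-zip-swap z₂))
                         (trans (sym fx≡) (trans fx≡fy fy≡))
    with refl ← zip-functional (distinct C′) (∈-zip-swap z₁) (∈-zip-swap z₂)
    = trans x≡ (sym y≡)

  f-surjective : Surjective _≡_ _≡_ f
  f-surjective y
    with M′ , t′ , n , p , refl ← covers C′ y
    with e , z ← ∈-zip⁺ˡ {ys = L} (sym |L|≡|L′|) p
    = e at n , λ { refl → f-at n (∈-zip-swap z) }

quotRem-unique : ∀ m .{{_ : NonZero m}} {n n′ t t′} → t < m → t′ < m →
                 m * n + t ≡ m * n′ + t′ → n ≡ n′ × t ≡ t′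
quotRem-unique m {n} {n′} {t} {t′} t<m t′<m eq = n≡n′ , t≡t′
  where
  [m*k+r]%m≡r : ∀ {k r} → r < m → (m * k + r) % m ≡ r
  [m*k+r]%m≡r {k} {r} r<m = begin
    (m * k + r) % m ≡⟨ cong (_% m) (trans (+-comm (m * k) r) (cong (r +_) (*-comm m k))) ⟩
    (r + k * m) % m ≡⟨ [m+kn]%n≡m%n r k m ⟩
    r % m           ≡⟨ m<n⇒m%n≡m r<m ⟩
    r               ∎
    where open ≡-Reasoning

  t≡t′ : t ≡ t′
  t≡t′ = trans (sym ([m*k+r]%m≡r t<m)) (trans (cong (_% m) eq) ([m*k+r]%m≡r t′<m))

  n≡n′ : n ≡ n′
  n≡n′ = *-cancelˡ-≡ n n′ m (+-cancelʳ-≡ t _ _ (trans eq (cong (m * n′ +_) (sym t≡t′))))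

m≡n*[m/n]+m%n : ∀ m n .{{_ : NonZero n}} → m ≡ n * (m / n) + m % n
m≡n*[m/n]+m%n m n =
  trans (m≡m%n+[m/n]*n m n) (trans (+-comm (m % n) _) (cong (_+ m % n) (*-comm (m / n) n)))

∤-offset : ∀ {b} q {s} → suc s < b → ¬ b ∣ q * b + suc s
∤-offset q s<b b∣ = <⇒≱ s<b (∣⇒≤ (∣m+n∣m⇒∣n b∣ (n∣m*n q)))

module _ (b : ℕ) where

  private
    b∤? : (r : ℕ) → Dec (¬ b ∣ r)
    b∤? r = ¬? (b ∣? r)

  nonMultiplesUpTo : ℕ → List ℕ
  nonMultiplesUpTo n = filter b∤? (map suc (upTo n))

  private
    count : ℕ → ℕ
    count n = length (nonMultiplesUpTo n)

  count-suc : ∀ n → count (suc n) ≡ count n + length (filter b∤? [ suc n ])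
  count-suc n = begin
    length (filter b∤? (map suc (upTo (suc n))))
      ≡⟨ cong (λ l → length (filter b∤? (map suc l))) (sym (upTo-∷ʳ n)) ⟩
    length (filter b∤? (map suc (upTo n ++ [ n ])))
      ≡⟨ cong (λ l → length (filter b∤? l)) (map-++ suc (upTo n) [ n ]) ⟩
    length (filter b∤? (map suc (upTo n) ++ [ suc n ]))
      ≡⟨ cong length (filter-++ b∤? (map suc (upTo n)) [ suc n ]) ⟩
    length (nonMultiplesUpTo n ++ filter b∤? [ suc n ])
      ≡⟨ length-++ (nonMultiplesUpTo n) ⟩
    count n + length (filter b∤? [ suc n ])
      ∎
    where open ≡-Reasoning

  count-suc-multiple : ∀ {n} → b ∣ suc n → count (suc n) ≡ count n
  count-suc-multiple {n} b∣ = trans (count-suc n)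
    (trans (cong (λ l → count n + length l) (filter-reject b∤? (λ b∤ → b∤ b∣))) (+-identityʳ _))

  count-suc-nonMultiple : ∀ {n} → ¬ b ∣ suc n → count (suc n) ≡ suc (count n)
  count-suc-nonMultiple {n} b∤ = trans (count-suc n)
    (trans (cong (λ l → count n + length l) (filter-accept b∤? b∤)) (+-comm _ 1))

  nonMultiplesUpTo-distinct : ∀ n → Unique (nonMultiplesUpTo n)
  nonMultiplesUpTo-distinct n = Unique.filter⁺ b∤? (Unique.map⁺ suc-injective (Unique.upTo⁺ n))

module _ (b : ℕ) where

  private
    count : ℕ → ℕ
    count n = length (nonMultiplesUpTo (suc b) n)

  count-block : ∀ q {s} → s ≤ b → count (q * suc b + s) ≡ count (q * suc b) + s
  count-block q {zero}  _   =
    trans (cong count (+-identityʳ (q * suc b))) (sym (+-identityʳ (count (q * suc b))))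
  count-block q {suc s} s<b = begin
    count (q * suc b + suc s)    ≡⟨ cong count (+-suc (q * suc b) s) ⟩
    count (suc (q * suc b + s))  ≡⟨ count-suc-nonMultiple (suc b) b∤ ⟩
    suc (count (q * suc b + s))  ≡⟨ cong suc (count-block q (<⇒≤ s<b)) ⟩
    suc (count (q * suc b) + s)  ≡⟨ +-suc _ s ⟨
    count (q * suc b) + suc s    ∎
    where
    open ≡-Reasoning
    b∤ : ¬ suc b ∣ suc (q * suc b + s)
    b∤ = subst (λ m → ¬ suc b ∣ m) (+-suc (q * suc b) s) (∤-offset q (s≤s s<b))

  count-multiple : ∀ q → count (q * suc b) ≡ q * b
  count-multiple zero    = refl
  count-multiple (suc q) = begin
    count (suc (b + q * suc b))  ≡⟨ cong (count ∘ suc) (+-comm b (q * suc b)) ⟩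
    count (suc (q * suc b + b))  ≡⟨ count-suc-multiple (suc b) b∣ ⟩
    count (q * suc b + b)        ≡⟨ count-block q ≤-refl ⟩
    count (q * suc b) + b        ≡⟨ cong (_+ b) (count-multiple q) ⟩
    q * b + b                    ≡⟨ +-comm _ b ⟩
    suc q * b                    ∎
    where
    open ≡-Reasoning
    b∣ : suc b ∣ suc (q * suc b + b)
    b∣ = divides (suc q) (cong suc (+-comm (q * suc b) b))

  length-nonMultiplesUpTo : ∀ q {s} → s ≤ b → count (q * suc b + s) ≡ q * b + s
  length-nonMultiplesUpTo q s≤b = trans (count-block q s≤b) (cong (_+ _) (count-multiple q))

length-residues : ∀ a b → length (residues a b) ≡ a * (b ∸ 1)
length-residues zero    b       = refl
length-residues (suc a) zero    rewrite *-zeroʳ a = refl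
length-residues (suc a) (suc b) = begin
  length (nonMultiplesUpTo (suc b) (b + a * suc b))
    ≡⟨ cong (length ∘ nonMultiplesUpTo (suc b)) (+-comm b (a * suc b)) ⟩
  length (nonMultiplesUpTo (suc b) (a * suc b + b))
    ≡⟨ length-nonMultiplesUpTo b a ≤-refl ⟩
  a * b + b                                          ≡⟨ +-comm _ b ⟩
  suc a * b                                          ∎
  where open ≡-Reasoning

length-classes : ∀ a b fa → length (classes a b fa) ≡ a * (b ∸ 1) + fa
length-classes a b fa = begin
  length (map _ (upTo fa) ++ map _ (residues a b))  ≡⟨ length-++ (map _ (upTo fa)) ⟩
  length (map _ (upTo fa)) + length (map _ (residues a b))
    ≡⟨ cong₂ _+_ (trans (length-map _ (upTo fa)) (length-upTo fa))
                 (trans (length-map _ (residues a b)) (length-residues a b)) ⟩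
  fa + a * (b ∸ 1)                                  ≡⟨ +-comm fa _ ⟩
  a * (b ∸ 1) + fa                                  ∎
  where open ≡-Reasoning

∈-residues⁻ : ∀ {a b r} → r ∈ residues a b → r < a * b × ¬ b ∣ r
∈-residues⁻ {a} {b} r∈
  with r∈′ , b∤r ← ∈-filter⁻ (λ r → ¬? (b ∣? r)) {xs = map suc (upTo (a * b ∸ 1))} r∈
  with r , r∈upTo , refl ← ∈-map⁻ suc r∈′ =
  pred-cancel-< (subst (r <_) (sym (pred[m∸n]≡m∸[1+n] (a * b) 0)) (∈-upTo⁻ r∈upTo)) , b∤r

∈-residues⁺ : ∀ {a b r} → r < a * b → ¬ b ∣ r → r ∈ residues a b
∈-residues⁺ {r = zero}  _     b∤0 = contradiction (divides 0 refl) b∤0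
∈-residues⁺ {a} {b} {suc r} r<ab b∤r =
  ∈-filter⁺ (λ r → ¬? (b ∣? r)) (∈-map⁺ suc (∈-upTo⁺ r<ab∸1)) b∤r
  where
  r<ab∸1 : r < a * b ∸ 1
  r<ab∸1 = subst (r <_) (pred[m∸n]≡m∸[1+n] (a * b) 0) (<⇒≤pred r<ab)

data ClassOf (a b fa : ℕ) : Class → Set where
  multiple    : ∀ {i} → i < fa → ClassOf a b fa (fa * b , i * b)
  nonMultiple : ∀ {r} → r < a * b → ¬ b ∣ r → ClassOf a b fa (a * b , r)

∈-classes⁻ : ∀ {a b fa e} → e ∈ classes a b fa → ClassOf a b fa e
∈-classes⁻ {a} {b} {fa} p with ∈-++⁻ (map (λ i → (fa * b , i * b)) (upTo fa)) p
... | inj₁ q with i , i∈ , refl ← ∈-map⁻ _ {xs = upTo fa} q = multiple (∈-upTo⁻ i∈)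
... | inj₂ q with r , r∈ , refl ← ∈-map⁻ _ {xs = residues a b} q =
  uncurry nonMultiple (∈-residues⁻ {a} r∈)

∈-classes⁺ : ∀ {a b fa e} → ClassOf a b fa e → e ∈ classes a b fa
∈-classes⁺ (multiple i<fa) = ∈-++⁺ˡ (∈-map⁺ _ (∈-upTo⁺ i<fa))
∈-classes⁺ {a} {b} {fa} (nonMultiple r<ab b∤r) =
  ∈-++⁺ʳ (map (λ i → (fa * b , i * b)) (upTo fa)) (∈-map⁺ _ (∈-residues⁺ {a} r<ab b∤r))

scale-at : ∀ M t n b → (M * b , t * b) at n ≡ (M , t) at n * b
scale-at = distrib
  where
  distrib : ∀ M t n b → M * b * n + t * b ≡ (M * n + t) * b
  distrib = solve-∀

module _ (a b fa : ℕ) .{{_ : NonZero a}} .{{_ : NonZero b}} .{{_ : NonZero fa}} where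

  private instance
    ab≢0 : NonZero (a * b)
    ab≢0 = m*n≢0 a b

  classes-distinct : Unique (classes a b fa)
  classes-distinct =
    Unique.++⁺ (Unique.map⁺ (λ eq → *-cancelʳ-≡ _ _ b (cong proj₂ eq)) (Unique.upTo⁺ fa))
               (Unique.map⁺ (cong proj₂) (nonMultiplesUpTo-distinct b (a * b ∸ 1)))
               parts-disjoint
    where
    multiples = map (λ i → (fa * b , i * b)) (upTo fa)
    nonMultiples = map (λ r → (a * b , r)) (residues a b)

    parts-disjoint : ∀ {e} → ¬ (e ∈ multiples × e ∈ nonMultiples)
    parts-disjoint (p , q)
      with i , _ , refl ← ∈-map⁻ (λ i → (fa * b , i * b)) {xs = upTo fa} p
         | r , r∈ , e≡ ← ∈-map⁻ (λ r → (a * b , r)) {xs = residues a b} q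
      = proj₂ (∈-residues⁻ {a} r∈) (subst (b ∣_) (cong proj₂ e≡) (n∣m*n i))

  classes-covers : Covers (classes a b fa)
  classes-covers x with b ∣? x
  ... | yes (divides q refl) =
    fa * b , q % fa * b , q / fa , ∈-classes⁺ {a} {b} {fa} (multiple (m%n<n q fa)) ,
    trans (cong (_* b) (m≡n*[m/n]+m%n q fa)) (sym (scale-at fa (q % fa) (q / fa) b))
  ... | no b∤x =
    a * b , x % (a * b) , x / (a * b) ,
    ∈-classes⁺ {a} {b} {fa} (nonMultiple (m%n<n x (a * b)) (b∤x ∘ ∣n∣m%n⇒∣m (n∣m*n a))) ,
    m≡n*[m/n]+m%n x (a * b)

  multiple-at-∣ : ∀ i n → b ∣ (fa * b , i * b) at n
  multiple-at-∣ i n = ∣m∣n⇒∣m+n (n∣m*n*o fa n) (n∣m*n i)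

  nonMultiple-at-∤ : ∀ {r} → ¬ b ∣ r → ∀ n → ¬ b ∣ (a * b , r) at n
  nonMultiple-at-∤ b∤r n b∣ = b∤r (∣m+n∣m⇒∣n b∣ (n∣m*n*o a n))

  classes-disjoint : Disjoint (classes a b fa)
  classes-disjoint n n′ p p′ eq with ∈-classes⁻ {a} {b} {fa} p | ∈-classes⁻ {a} {b} {fa} p′
  ... | multiple {i} i< | multiple {i′} i′<
    with refl , refl ← quotRem-unique fa i< i′<
                 (*-cancelʳ-≡ _ _ b (trans (sym (scale-at fa i n b)) (trans eq (scale-at fa i′ n′ b))))
    = refl , refl
  ... | nonMultiple r< _ | nonMultiple r′< _
    with refl , refl ← quotRem-unique (a * b) r< r′< eq
    = refl , refl
  ... | multiple {i} _ | nonMultiple _ b∤r =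
    contradiction (subst (b ∣_) eq (multiple-at-∣ i n)) (nonMultiple-at-∤ b∤r n′)
  ... | nonMultiple _ b∤r | multiple {i} _ =
    contradiction (subst (b ∣_) (sym eq) (multiple-at-∣ i n′)) (nonMultiple-at-∤ b∤r n)

  classes-exactCovering : ExactCovering (classes a b fa)
  classes-exactCovering = record
    { distinct = classes-distinct
    ; covers   = classes-covers
    ; disjoint = classes-disjoint
    }

lemma9 : (a b c d fa fc : ℕ) →
    a > 0 → c > 0 → b > 1 → d > 1 →
    gcd a c ≡ 1 → gcd b d ≡ 1 →
    fa > 0 → fc > 0 → fa ∣ a → fc ∣ c →
    a * (b ∸ 1) + fa ≡ c * (d ∸ 1) + fc →
    (∀ x → ∃ λ M → ∃ λ t → ∃ λ n → (M , t) ∈ classes a b fa × x ≡ M * n + t)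
    ×
    (Σ (ℕ → ℕ) λ f →
      (∀ M t M′ t′ n → ((M , t) , (M′ , t′)) ∈ zip (classes a b fa) (classes c d fc) →
         f (M * n + t) ≡ M′ * n + t′)
      × Bijective _≡_ _≡_ f)
lemma9 a b c d fa fc a>0 c>0 b>1 d>1 _ _ fa>0 fc>0 _ _ N≡N′ =
  ExactCovering.covers C , f , (λ _ _ _ _ n → f-at n) , f-injective , f-surjective
  where
  C : ExactCovering (classes a b fa)
  C = classes-exactCovering a b fa {{>-nonZero a>0}} {{>-nonZero (<-trans z<s b>1)}} {{>-nonZero fa>0}}
  C′ : ExactCovering (classes c d fc)
  C′ = classes-exactCovering c d fc {{>-nonZero c>0}} {{>-nonZero (<-trans z<s d>1)}} {{>-nonZero fc>0}}
  open Matching C C′ (trans (length-classes a b fa) (trans N≡N′ (sym (length-classes c d fc))))
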